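{- For every resource $\lambda\mu$-term $t$, every resource $\lambda\mu$-term $t'$ and every sum $\mathcal T$, if $t\to_r t'+\mathcal T$ then $\mathbf{m}(t)>\mathbf{m}(t')$, where $\mathbf{m}(t):=(\mathrm{ms}(t),\deg_\mu(t))$ is ordered lexicographically (first component by the multiset order on finite multisets of natural numbers, second by the usual order on $\mathbb N$). Consequently, the resource reduction $\to_r$ on sums is strongly normalising.
   Context: Fix disjoint countably infinite sets of variables $x,y,z,\dots$ and names $\alpha,\beta,\gamma,\eta,\dots$. Resource $\lambda\mu$-terms are generated by $t::=x\mid \lambda x.t\mid t[t_1,\dots,t_n]\mid \mu\alpha.{}_{\beta}|t|$ with $n\ge 0$. - $[t_1,\dots,t_n]$ is a finite multiset, called a bag; $1$ denotes the empty bag and $*$ denotes multiset union. - $\lambda$ binds $x$ and $\mu$ binds $\alpha$ in ${}_\beta|t|$; terms are considered up to renaming of bound variables and names. - A word ${}_\beta|t|$ is called a named term. Sums. - A sum is a finite set of resource terms, written as a formal sum with commutative, associative, idempotent $+$; $0$ denotes the empty sum. - The constructors are extended to sums multilinearly, e.g. $(\sum_i t_i)[\sum_{j_1} u_{j_1},\dots]=\sum_{i,j_1,\dots} t_i[u_{j_1},\dots]$, and $0$ occurring anywhere annihilates the whole term. Weak compositions. A weak composition (w.c.) of a bag $B$ is a tuple $(B_0,\dots,B_k)$ of possibly empty bags with $B_0*\cdots*B_k=B$. Linear substitution $t\langle B/x\rangle$ (a sum): - $x\langle [v]/x\rangle=v$; $x\langle B/x\rangle=0$ if $B$ does not have exactly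 one element. - For $y\ne x$: $y\langle 1/x\rangle=y$ and $y\langle B/x\rangle=0$ if $B\ne 1$. - $(\lambda y.t)\langle B/x\rangle=\lambda y.t\langle B/x\rangle$ and $(\mu\alpha.{}_\beta|t|)\langle B/x\rangle=\mu\alpha.{}_\beta|t\langle B/x\rangle|$. - $(t[v_1,\dots,v_n])\langle B/x\rangle=\sum_{(B_0,\dots,B_n)\text{ w.c. of }B} t\langle B_0/x\rangle[v_1\langle B_1/x\rangle,\dots,v_n\langle B_n/x\rangle]$. Linear named application $\langle t\rangle_\alpha B$: - $\langle x\rangle_\alpha 1=x$ and $\langle x\rangle_\alpha B=0$ if $B\ne1$. - $\langle\lambda y.t\rangle_\alpha B=\lambda y.\langle t\rangle_\alpha B$ and $\langle\mu\gamma.{}_\eta|t|\rangle_\alpha B=\mu\gamma.\langle{}_\eta|t|\rangle_\alpha B$. - On named terms: $\langle{}_\eta|t|\rangle_\alpha B={}_\eta|\langle t\rangle_\alpha B|$ if $\eta\neq\alpha$, and $\langle{}_\alpha|t|\rangle_\alpha B=\sum_{(B_1,B_2)\text{ w.c. of }B}{}_\alpha|(\langle t\rangle_\alpha B_1)B_2|$. - $\langle t[v_1,\dots,v_n]\rangle_\alpha B=\sum_{(B_0,\dots,B_n)\text{ w.c. of }B}(\langle t\rangle_\alpha B_0)[\langle v_1\rangle_\alpha B_1,\dots,\langle v_n\rangle_\alpha B_n]$. Resource reduction. $\to_r$ is the closure under single-hole resource contexts of the three rules - $(\lambda x.t)B\to t\langle B/x\rangle$ ($\lambda^r$), - $(\mu\alpha.{}_\beta|t|)B\to\mu\alpha.\langle{}_\beta|t|\rangle_\alpha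 B$ ($\mu^r$), - $\mu\gamma.{}_\alpha|\mu\beta.{}_\eta|t||\to\mu\gamma.({}_\eta|t|)\{\alpha/\beta\}$ ($\rho^r$), where $\{\alpha/\beta\}$ renames free occurrences of $\beta$ into $\alpha$. It is extended to sums by $t+\mathcal S\to_r\mathcal T+\mathcal S$ whenever $t\to_r\mathcal T$ and $t\notin\mathcal S$. Strong normalisation means there is no infinite sequence of $\to_r$-steps between sums. Measures. - $\deg_\mu(t)$ is the number of $\mu$-abstractions in $t$. - For an occurrence $b$ of a bag in $t$, the depth $d_t(b)$ is the number of named subterms ${}_\beta|s|$ of $t$ containing $b$. - $\mathrm{ms}(t)$ is the finite multiset $[\deg_\mu(t)-d_t(b)\mid b\text{ occurrence of a bag in }t]$ of natural numbers, compared with the (well-founded) multiset order induced by $<$ on $\mathbb N$. -}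

module Defs where

open import Data.Nat using (ℕ; zero; suc; _+_; _∸_; _<_; _≡ᵇ_; _<ᵇ_; pred)
open import Data.Bool using (if_then_else_)
open import Data.List using (List; []; _∷_; _++_; map; concatMap; sum)
open import Data.Product using (_×_; _,_; Σ; ∃; ∃-syntax)
open import Data.Sum using (_⊎_)
open import Data.Empty using (⊥)
open import Relation.Nullary using (¬_)
open import Relation.Binary.PropositionalEquality using (_≡_)
open import Data.List.Relation.Unary.All using (All)
open import Data.List.Relation.Unary.Any using (Any)
open import Data.List.Relation.Binary.Pointwise using (Pointwise)
open import Data.List.Relation.Binary.Permutation.Propositional using (_↭_)
open import Function.Bundles using (_⇔_)

-- Resource λμ-terms, locally nameless-free: de Bruijn indices, with two
-- independent index spaces (variables, bound by lam; names, bound by mu).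
--   var x        : variable with de Bruijn index x
--   lam t        : λx.t   (x = variable index 0 in t)
--   app t B      : t B    (B a bag, represented by a list; bags are
--                          multisets, see _≃_ below)
--   mu β t       : μα.β|t|  (α = name index 0 in t and in β;
--                            β is the name index of the named term,
--                            in the scope where α is bound)

data Term : Set where
  var : ℕ → Term
  lam : Term → Term
  app : Term → List Term → Term
  mu  : ℕ → Term → Term

Bag : Set
Bag = List Term

-- A sum is a finite set of terms; represented by a list, taken up to the
-- set equality _≈ˢ_ below.
Sum : Set
Sum = List Term

mutual
  data _≃_ : Term → Term → Set where
    var : ∀ {x} → var x ≃ var x
    lam : ∀ {t u} → t ≃ u → lam t ≃ lam u
    app : ∀ {t u B C} → t ≃ u → B ≃ᵇ C → app t B ≃ app u C
    mu  : ∀ {b t u} → t ≃ u → mu b t ≃ mu b u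

  data _≃ᵇ_ : Bag → Bag → Set where
    bagEq : ∀ {B C D} → Pointwise _≃_ B D → D ↭ C → B ≃ᵇ C

_∈ˢ_ : Term → Sum → Set
t ∈ˢ S = Any (t ≃_) S

_≈ˢ_ : Sum → Sum → Set
S ≈ˢ T = ∀ t → (t ∈ˢ S) ⇔ (t ∈ˢ T)

liftR : (ℕ → ℕ) → ℕ → ℕ
liftR f zero    = zero
liftR f (suc k) = suc (f k)

mutual
  renV : (ℕ → ℕ) → Term → Term
  renV f (var x)   = var (f x)
  renV f (lam t)   = lam (renV (liftR f) t)
  renV f (app t B) = app (renV f t) (renVL f B)
  renV f (mu b t)  = mu b (renV f t)

  renVL : (ℕ → ℕ) → Bag → Bag
  renVL f []      = []
  renVL f (v ∷ B) = renV f v ∷ renVL f B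

mutual
  renN : (ℕ → ℕ) → Term → Term
  renN f (var x)   = var x
  renN f (lam t)   = lam (renN f t)
  renN f (app t B) = app (renN f t) (renNL f B)
  renN f (mu b t)  = mu (liftR f b) (renN (liftR f) t)

  renNL : (ℕ → ℕ) → Bag → Bag
  renNL f []      = []
  renNL f (v ∷ B) = renN f v ∷ renNL f B

-- Weak compositions into two parts: every way of distributing the
-- elements of the list B into (B₁ , B₂).  (As multisets, iterating this
-- enumerates all weak compositions, possibly with repetitions, which is
-- harmless since sums are idempotent.)

splits : Bag → List (Bag × Bag)
splits []      = ([] , []) ∷ []
splits (a ∷ B) = concatMap (λ { (l , r) → (a ∷ l , r) ∷ (l , a ∷ r) ∷ [] }) (splits B)

-- Linear substitution t⟨B/x⟩, combined with the decrement of the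
-- variables above x (x is removed from scope: used for the λ-rule).
-- B lives in the scope of the result.

substVar : ℕ → ℕ → Bag → Sum
substVar k x B = if k ≡ᵇ x then one B else none B
  where
    one : Bag → Sum
    one (v ∷ []) = v ∷ []
    one _        = []
    none : Bag → Sum
    none [] = var (if k <ᵇ x then k else pred k) ∷ []
    none _  = []

mutual
  lsub : Term → ℕ → Bag → Sum
  lsub (var k)    x B = substVar k x B
  lsub (lam t)    x B = map lam (lsub t (suc x) (renVL suc B))
  lsub (mu b t)   x B = map (mu b) (lsub t x (renNL suc B))
  lsub (app t vs) x B =
    concatMap (λ { (B₀ , B') →
      concatMap (λ s → map (app s) (lsubL vs x B')) (lsub t x B₀) })
      (splits B)

  lsubL : Bag → ℕ → Bag → List Bag
  lsubL []       x []      = [] ∷ []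
  lsubL []       x (_ ∷ _) = []
  lsubL (v ∷ vs) x B =
    concatMap (λ { (B₁ , B₂) →
      concatMap (λ s → map (s ∷_) (lsubL vs x B₂)) (lsub v x B₁) })
      (splits B)

-- Linear named application ⟨t⟩_α B.  B lives in the scope of t.

mutual
  napp : Term → ℕ → Bag → Sum
  napp (var k)    α []      = var k ∷ []
  napp (var k)    α (_ ∷ _) = []
  napp (lam t)    α B = map lam (napp t α (renVL suc B))
  napp (mu η t)   α B = map (mu η) (nappNamed η t (suc α) (renNL suc B))
  napp (app t vs) α B =
    concatMap (λ { (B₀ , B') →
      concatMap (λ s → map (app s) (nappL vs α B')) (napp t α B₀) })
      (splits B)

  nappL : Bag → ℕ → Bag → List Bag
  nappL []       α []      = [] ∷ []
  nappL []       α (_ ∷ _) = []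
  nappL (v ∷ vs) α B =
    concatMap (λ { (B₁ , B₂) →
      concatMap (λ s → map (s ∷_) (nappL vs α B₂)) (napp v α B₁) })
      (splits B)

  -- ⟨η|t|⟩_α B, returning the sum of the bodies of the resulting named
  -- terms (all of which are named η)
  nappNamed : ℕ → Term → ℕ → Bag → Sum
  nappNamed η t α B =
    if η ≡ᵇ α
    then concatMap (λ { (B₁ , B₂) → map (λ s → app s B₂) (napp t α B₁) }) (splits B)
    else napp t α B

-- ρ-renaming {α/β} for μγ.α|μβ.η|t||: β (index 0 of the inner scope)
-- becomes α (index a of the outer scope), the other names go down by one.

rhoRen : ℕ → ℕ → ℕ
rhoRen a zero    = a
rhoRen a (suc k) = k

data _⟶_ : Term → Sum → Set where
  βr   : ∀ {t B} → app (lam t) B ⟶ lsub t 0 B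
  μr   : ∀ {b t B} → app (mu b t) B ⟶ map (mu b) (nappNamed b t 0 (renNL suc B))
  ρr   : ∀ {a e t} → mu a (mu e t) ⟶ (mu (rhoRen a e) (renN (rhoRen a) t) ∷ [])
  lamᶜ : ∀ {t T} → t ⟶ T → lam t ⟶ map lam T
  muᶜ  : ∀ {b t T} → t ⟶ T → mu b t ⟶ map (mu b) T
  appˡ : ∀ {t T B} → t ⟶ T → app t B ⟶ map (λ s → app s B) T
  appʳ : ∀ {t B₁ u B₂ U} → u ⟶ U →
         app t (B₁ ++ u ∷ B₂) ⟶ map (λ s → app t (B₁ ++ s ∷ B₂)) U

data _⟶ˢ_ : Sum → Sum → Set where
  step : ∀ {S S' t T R} → t ⟶ T → ¬ (t ∈ˢ R) →
         S ≈ˢ (t ∷ R) → S' ≈ˢ (T ++ R) → S ⟶ˢ S'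

StronglyNormalising : Set
StronglyNormalising = (f : ℕ → Sum) → ¬ (∀ n → f n ⟶ˢ f (suc n))

mutual
  degμ : Term → ℕ
  degμ (var x)   = 0
  degμ (lam t)   = degμ t
  degμ (app t B) = degμ t + degμL B
  degμ (mu b t)  = suc (degμ t)

  degμL : Bag → ℕ
  degμL []      = 0
  degμL (v ∷ B) = degμ v + degμL B

-- depths d_t(b) of all bag occurrences b in t (number of named subterms
-- containing b, i.e. number of μ-abstractions above b)
mutual
  depths : Term → List ℕ
  depths (var x)   = []
  depths (lam t)   = depths t
  depths (app t B) = 0 ∷ (depths t ++ depthsL B)
  depths (mu b t)  = map suc (depths t)

  depthsL : Bag → List ℕ
  depthsL []      = []
  depthsL (v ∷ B) = depths v ++ depthsL B

ms : Term → List ℕ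
ms t = map (degμ t ∸_) (depths t)

_<ₘ_ : List ℕ → List ℕ → Set
M <ₘ N = Σ (List ℕ) λ X → Σ (List ℕ) λ Y → Σ (List ℕ) λ Z →
           (N ↭ Z ++ X) × (M ↭ Z ++ Y) × ¬ (X ≡ []) ×
           All (λ y → Any (y <_) X) Y

𝐦 : Term → List ℕ × ℕ
𝐦 t = ms t , degμ t

_<ˡᵉˣ_ : List ℕ × ℕ → List ℕ × ℕ → Set
(M , m) <ˡᵉˣ (N , n) = (M <ₘ N) ⊎ ((M ↭ N) × (m < n))

-- A λ-step deletes one bag at the top and moves the bags of the argument to
-- depths at least as large; a μ-step deletes the bag it consumes and creates new ones only under the μ,
-- hence strictly deeper; a ρ-step changes no depth but removes a μ. Measuring bag depths against a fixed
-- ambient μ-degree makes these decreases stable under contexts. The lexicographic order on 𝐦 is well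
-- founded (Dershowitz–Manna), and a step on sums replaces one element of a duplicate-free representation
-- by finitely many smaller ones, so an infinite reduction would descend forever in the multiset
-- extension of that order.

module Submission where

open import Defs
open import Data.List using (_∷_)
open import Data.Product using (_×_)

open import Level using (0ℓ)
open import Function.Base using (_∘_; _on_)
open import Function.Bundles using (Equivalence; mk⇔)
open import Data.Empty using (⊥)
open import Data.Bool using (true; false)
open import Data.Nat using (ℕ; zero; suc; _+_; _∸_; _<_; _≤_; s≤s⁻¹; _≡ᵇ_)
open import Data.Nat.Properties
  using (≤-refl; ≤-trans; m≤n⇒m<n∨m≡n; m∸n≤m; ∸-+-assoc; ∸-monoˡ-≤; n<1+n; n≤1+n;
         m≤m+n; ≤-<-trans; +-identityʳ; +-comm; +-assoc; m+n∸n≡m)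
open import Data.Nat.Induction using (<-wellFounded)
open import Data.Nat.Tactic.RingSolver using (solve-∀)
open import Data.List using (List; []; _++_; map; concatMap; [_])
import Data.List.Properties as List
open import Data.List.Relation.Unary.All as All using (All; []; _∷_)
import Data.List.Relation.Unary.All.Properties as All
open import Data.List.Relation.Unary.Any as Any using (Any; here; there)
import Data.List.Relation.Unary.Any.Properties as Any
open import Data.List.Relation.Unary.AllPairs using ([]; _∷_)
open import Data.List.Relation.Binary.Pointwise using (Pointwise; []; _∷_)
open import Data.List.Relation.Binary.Permutation.Propositional as ↭
  using (_↭_; prep; swap; ↭-refl; ↭-sym; ↭-trans; ↭-reflexive; ↭⇒↭ₛ′)
open import Data.List.Relation.Binary.Permutation.Propositional.Properties
  using (++⁺; ++⁺ˡ; ++⁺ʳ; ++-assoc; ++-comm; ++-identityʳ; shift; shifts; drop-∷;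
         ↭-empty-inv; ∈-resp-↭; Any-resp-↭)
open import Data.List.Membership.Propositional using (_∈_; find)
open import Data.List.Membership.Propositional.Properties using (∈-map⁻; ∈-concatMap⁻; ∈-∃++)
open import Data.Product using (Σ; ∃; ∃₂; _,_)
open import Data.Sum using (_⊎_; inj₁; inj₂)
open import Relation.Nullary using (¬_; Dec; yes; no)
open import Relation.Nullary.Negation using (¬¬-Monad; ¬¬-map; contradiction)
open import Relation.Nullary.Decidable using (¬¬-excluded-middle)
open import Relation.Binary.PropositionalEquality
  using (_≡_; _≢_; refl; sym; trans; cong; cong₂; subst; subst₂; module ≡-Reasoning)
open import Relation.Binary.Bundles using (Setoid)
open import Relation.Binary.Construct.Closure.Transitive as Transitive using (TransClosure; _∷ʳ_)
import Relation.Binary.Construct.On as On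
open import Induction.WellFounded using (Acc; acc; WellFounded; module Subrelation)
open import Data.Product.Relation.Binary.Lex.Strict using (×-wellFounded')
import Data.List.Relation.Unary.Unique.Setoid.Properties as Unique
import Data.List.Relation.Binary.Subset.Setoid.Properties as Subset
import Data.List.Membership.Setoid.Properties as Membershipₛ
open import Effect.Monad using (RawMonad)

↭-interchange : ∀ {A : Set} (a b c d : List A) → (a ++ b) ++ (c ++ d) ↭ (a ++ c) ++ (b ++ d)
↭-interchange a b c d =
  ↭-trans (++-assoc a b (c ++ d)) (↭-trans (++⁺ˡ a (shifts b c)) (↭-sym (++-assoc a c (b ++ d))))

infix 4 _≤ₘ_
_≤ₘ_ : List ℕ → List ℕ → Set
M ≤ₘ N = Σ (List ℕ) λ X → Σ (List ℕ) λ Y → Σ (List ℕ) λ Z →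
           (N ↭ Z ++ X) × (M ↭ Z ++ Y) × All (λ y → Any (y <_) X) Y

<ₘ⇒≤ₘ : ∀ {M N} → M <ₘ N → M ≤ₘ N
<ₘ⇒≤ₘ (X , Y , Z , N↭ , M↭ , _ , Y<X) = X , Y , Z , N↭ , M↭ , Y<X

≤ₘ-reflexive : ∀ {M N} → M ↭ N → M ≤ₘ N
≤ₘ-reflexive {N = N} M↭N =
  [] , [] , N , ↭-sym (++-identityʳ N) , ↭-trans M↭N (↭-sym (++-identityʳ N)) , []

≤ₘ-refl : ∀ {M} → M ≤ₘ M
≤ₘ-refl = ≤ₘ-reflexive ↭-refl

≤ₘ-resp-↭ : ∀ {M M' N N'} → M' ↭ M → N ↭ N' → M ≤ₘ N → M' ≤ₘ N'
≤ₘ-resp-↭ M'↭M N↭N' (X , Y , Z , N↭ , M↭ , Y<X) =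
  X , Y , Z , ↭-trans (↭-sym N↭N') N↭ , ↭-trans M'↭M M↭ , Y<X

<ₘ-resp-↭ : ∀ {M M' N N'} → M' ↭ M → N ↭ N' → M <ₘ N → M' <ₘ N'
<ₘ-resp-↭ M'↭M N↭N' (X , Y , Z , N↭ , M↭ , X≢[] , Y<X) =
  X , Y , Z , ↭-trans (↭-sym N↭N') N↭ , ↭-trans M'↭M M↭ , X≢[] , Y<X

++-mono-≤ₘ : ∀ {M₁ N₁ M₂ N₂} → M₁ ≤ₘ N₁ → M₂ ≤ₘ N₂ → M₁ ++ M₂ ≤ₘ N₁ ++ N₂
++-mono-≤ₘ (X₁ , Y₁ , Z₁ , N₁↭ , M₁↭ , Y₁<X₁) (X₂ , Y₂ , Z₂ , N₂↭ , M₂↭ , Y₂<X₂) =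
  X₁ ++ X₂ , Y₁ ++ Y₂ , Z₁ ++ Z₂ ,
  ↭-trans (++⁺ N₁↭ N₂↭) (↭-interchange Z₁ X₁ Z₂ X₂) ,
  ↭-trans (++⁺ M₁↭ M₂↭) (↭-interchange Z₁ Y₁ Z₂ Y₂) ,
  All.++⁺ (All.map Any.++⁺ˡ Y₁<X₁) (All.map (Any.++⁺ʳ X₁) Y₂<X₂)

++-mono-<ₘ-≤ₘ : ∀ {M₁ N₁ M₂ N₂} → M₁ <ₘ N₁ → M₂ ≤ₘ N₂ → (M₁ ++ M₂) <ₘ (N₁ ++ N₂)
++-mono-<ₘ-≤ₘ M₁<N₁@(X₁ , _ , _ , _ , _ , X₁≢[] , _) M₂≤N₂ =
  let X , Y , Z , N↭ , M↭ , Y<X = ++-mono-≤ₘ (<ₘ⇒≤ₘ M₁<N₁) M₂≤N₂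
  in  X , Y , Z , N↭ , M↭ , X₁≢[] ∘ List.++-conicalˡ X₁ _ , Y<X

++-mono-≤ₘ-<ₘ : ∀ {M₁ N₁ M₂ N₂} → M₁ ≤ₘ N₁ → M₂ <ₘ N₂ → (M₁ ++ M₂) <ₘ (N₁ ++ N₂)
++-mono-≤ₘ-<ₘ M₁≤N₁@(X₁ , _) M₂<N₂@(_ , _ , _ , _ , _ , X₂≢[] , _) =
  let X , Y , Z , N↭ , M↭ , Y<X = ++-mono-≤ₘ M₁≤N₁ (<ₘ⇒≤ₘ M₂<N₂)
  in  X , Y , Z , N↭ , M↭ , X₂≢[] ∘ List.++-conicalʳ X₁ _ , Y<X

<ₘ-singleton : ∀ {x y} → x < y → [ x ] <ₘ [ y ]
<ₘ-singleton {x} {y} x<y = [ y ] , [ x ] , [] , ↭-refl , ↭-refl , (λ ()) , here x<y ∷ []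

≤ₘ-singleton : ∀ {x y} → x ≤ y → [ x ] ≤ₘ [ y ]
≤ₘ-singleton x≤y with m≤n⇒m<n∨m≡n x≤y
... | inj₁ x<y  = <ₘ⇒≤ₘ (<ₘ-singleton x<y)
... | inj₂ refl = ≤ₘ-refl

≤ₘ⇒<ₘ-∷ : ∀ {M N x} → M ≤ₘ N → M <ₘ (x ∷ N)
≤ₘ⇒<ₘ-∷ {x = x} (X , Y , Z , N↭ , M↭ , Y<X) =
  x ∷ X , Y , Z , ↭-trans (prep x N↭) (↭-sym (shift x Z X)) , M↭ , (λ ()) , All.map there Y<X

<ₘ-trade : ∀ {x Y} (N K : List ℕ) → All (_< x) Y → (N ++ Y) <ₘ (x ∷ N ++ K)
<ₘ-trade {x} {Y} N K Y<x =
  x ∷ K , Y , N , ↭-sym (shift x N K) , ↭-refl , (λ ()) , All.map here Y<x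

module MultisetExtension {A : Set} (_≺_ : A → A → Set) where

  infix 4 _◁_
  _◁_ : List A → List A → Set
  N ◁ M = Σ A λ a → Σ (List A) λ K → Σ (List A) λ Y → (M ↭ a ∷ K) × (N ↭ Y ++ K) × All (_≺ a) Y

  Acc-resp-↭ : ∀ {M M'} → Acc _◁_ M → M ↭ M' → Acc _◁_ M'
  Acc-resp-↭ (acc rs) M↭M' =
    acc λ (a , K , Y , M'↭ , N↭ , Y≺a) → rs (a , K , Y , ↭-trans M↭M' M'↭ , N↭ , Y≺a)

  ∷-↭-∷⁻ : ∀ {a c M K} → a ∷ M ↭ c ∷ K → (a ≡ c × M ↭ K) ⊎ (Σ (List A) λ K' → (M ↭ c ∷ K') × (K ↭ a ∷ K'))
  ∷-↭-∷⁻ {a} {c} a∷M↭c∷K with ∈-resp-↭ (↭-sym a∷M↭c∷K) (here refl)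
  ... | here refl = inj₁ (refl , drop-∷ a∷M↭c∷K)
  ... | there c∈M with ∈-∃++ c∈M
  ... | M₁ , M₂ , refl = inj₂ (M₁ ++ M₂ , shift c M₁ M₂ ,
          drop-∷ (↭-trans (↭-sym a∷M↭c∷K) (↭-trans (prep a (shift c M₁ M₂)) (swap a c ↭-refl))))

  SmallerAddable : A → Set
  SmallerAddable a = ∀ {b} → b ≺ a → ∀ {M} → Acc _◁_ M → Acc _◁_ (b ∷ M)

  acc-++ : ∀ {a} → SmallerAddable a → ∀ Y {M} → All (_≺ a) Y → Acc _◁_ M → Acc _◁_ (Y ++ M)
  acc-++ add []      []          accM = accM
  acc-++ add (y ∷ Y) (y≺a ∷ Y≺a) accM = add y≺a (acc-++ add Y Y≺a accM)

  acc-∷-addable : ∀ {a} → SmallerAddable a → ∀ {M} → Acc _◁_ M → Acc _◁_ (a ∷ M)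
  acc-∷-addable {a} add {M} (acc rs) = acc smaller
    where
    smaller : ∀ {N} → N ◁ a ∷ M → Acc _◁_ N
    smaller (c , K , Y , a∷M↭ , N↭ , Y≺c) with ∷-↭-∷⁻ a∷M↭
    ... | inj₁ (refl , M↭K) = Acc-resp-↭ (acc-++ add Y Y≺c (Acc-resp-↭ (acc rs) M↭K)) (↭-sym N↭)
    ... | inj₂ (K' , M↭ , K↭) =
          Acc-resp-↭ (acc-∷-addable add (rs (c , K' , Y , M↭ , ↭-refl , Y≺c)))
                     (↭-sym (↭-trans N↭ (↭-trans (++⁺ˡ Y K↭) (shift a Y K'))))

  acc-∷ : ∀ {a M} → Acc _≺_ a → Acc _◁_ M → Acc _◁_ (a ∷ M)
  acc-∷ (acc rs) = acc-∷-addable (λ b≺a → acc-∷ (rs b≺a))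

  ◁-wellFounded : WellFounded _≺_ → WellFounded _◁_
  ◁-wellFounded wf []      = acc λ (_ , _ , _ , []↭ , _) → contradiction (↭-empty-inv (↭-sym []↭)) λ ()
  ◁-wellFounded wf (a ∷ M) = acc-∷ (wf a) (◁-wellFounded wf M)

open MultisetExtension _<_ using () renaming (_◁_ to _◁ℕ_; ◁-wellFounded to ◁ℕ-wellFounded)

partition-below : ∀ {x X} Y → All (λ y → Any (y <_) (x ∷ X)) Y →
                  ∃₂ λ Y₁ Y₂ → (Y ↭ Y₁ ++ Y₂) × All (_< x) Y₁ × All (λ y → Any (y <_) X) Y₂
partition-below []      []            = [] , [] , ↭-refl , [] , []
partition-below (y ∷ Y) (y<x∷X ∷ Y<x∷X) with partition-below Y Y<x∷X | y<x∷X
... | Y₁ , Y₂ , Y↭ , Y₁<x , Y₂<X | here y<x  = y ∷ Y₁ , Y₂ , prep y Y↭ , y<x ∷ Y₁<x , Y₂<X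
... | Y₁ , Y₂ , Y↭ , Y₁<x , Y₂<X | there y<X =
      Y₁ , y ∷ Y₂ , ↭-trans (prep y Y↭) (↭-sym (shift y Y₁ Y₂)) , Y₁<x , y<X ∷ Y₂<X

-- The first ◁-step trades x for the elements Y₁ of Y below it, reaching (Z ++ Y₁) ++ X; the rest of X
-- is handled recursively.
dominated⇒◁⁺ : ∀ X {Y Z M N} → X ≢ [] → N ↭ Z ++ X → M ↭ Z ++ Y →
               All (λ y → Any (y <_) X) Y → TransClosure _◁ℕ_ M N
dominated⇒◁⁺ [] X≢[] _ _ _ = contradiction refl X≢[]
dominated⇒◁⁺ (x ∷ []) {Y} {Z} _ N↭ M↭ Y<x =
  Transitive.[ x , Z , Y , ↭-trans N↭ (++-comm Z [ x ]) , ↭-trans M↭ (++-comm Z Y) ,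
               All.map Any.singleton⁻ Y<x ]
dominated⇒◁⁺ (x ∷ X@(_ ∷ _)) {Y} {Z} _ N↭ M↭ Y<x∷X =
  let Y₁ , Y₂ , Y↭ , Y₁<x , Y₂<X = partition-below Y Y<x∷X
      M↭′ = ↭-trans M↭ (↭-trans (++⁺ˡ Z Y↭) (↭-sym (++-assoc Z Y₁ Y₂)))
      N↭′ = ↭-trans N↭ (shift x Z X)
      P↭  = ↭-trans (++⁺ʳ X (++-comm Z Y₁)) (++-assoc Y₁ Z X)
  in  dominated⇒◁⁺ X (λ ()) ↭-refl M↭′ Y₂<X ∷ʳ (x , Z ++ X , Y₁ , N↭′ , P↭ , Y₁<x)

<ₘ-wellFounded : WellFounded _<ₘ_
<ₘ-wellFounded = Subrelation.wellFounded <ₘ⇒◁⁺ (Transitive.wellFounded _◁ℕ_ (◁ℕ-wellFounded <-wellFounded))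
  where
  <ₘ⇒◁⁺ : ∀ {M N} → M <ₘ N → TransClosure _◁ℕ_ M N
  <ₘ⇒◁⁺ (X , Y , Z , N↭ , M↭ , X≢[] , Y<X) = dominated⇒◁⁺ X X≢[] N↭ M↭ Y<X

<ˡᵉˣ-wellFounded : WellFounded _<ˡᵉˣ_
<ˡᵉˣ-wellFounded = ×-wellFounded' ↭-trans (<ₘ-resp-↭ ↭-refl) <ₘ-wellFounded <-wellFounded

-- msAt D t is map (D ∸_) (depths t): freezing the ambient μ-degree D makes the measure compositional.
mutual
  msAt : ℕ → Term → List ℕ
  msAt D (var x)   = []
  msAt D (lam t)   = msAt D t
  msAt D (app t B) = D ∷ msAt D t ++ msAtL D B
  msAt D (mu b t)  = msAt (D ∸ 1) t

  msAtL : ℕ → Bag → List ℕ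
  msAtL D []      = []
  msAtL D (v ∷ B) = msAt D v ++ msAtL D B

mutual
  msAt≡map-depths : ∀ D t → msAt D t ≡ map (D ∸_) (depths t)
  msAt≡map-depths D (var x)   = refl
  msAt≡map-depths D (lam t)   = msAt≡map-depths D t
  msAt≡map-depths D (app t B) = cong (D ∷_) (begin
    msAt D t ++ msAtL D B
      ≡⟨ cong₂ _++_ (msAt≡map-depths D t) (msAtL≡map-depthsL D B) ⟩
    map (D ∸_) (depths t) ++ map (D ∸_) (depthsL B)
      ≡⟨ List.map-++ (D ∸_) (depths t) (depthsL B) ⟨
    map (D ∸_) (depths t ++ depthsL B)              ∎)
    where open ≡-Reasoning
  msAt≡map-depths D (mu b t)  = begin
    msAt (D ∸ 1) t                  ≡⟨ msAt≡map-depths (D ∸ 1) t ⟩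
    map ((D ∸ 1) ∸_) (depths t)     ≡⟨ List.map-cong (∸-+-assoc D 1) (depths t) ⟩
    map ((D ∸_) ∘ suc) (depths t)   ≡⟨ List.map-∘ (depths t) ⟩
    map (D ∸_) (map suc (depths t)) ∎
    where open ≡-Reasoning

  msAtL≡map-depthsL : ∀ D B → msAtL D B ≡ map (D ∸_) (depthsL B)
  msAtL≡map-depthsL D []      = refl
  msAtL≡map-depthsL D (v ∷ B) =
    trans (cong₂ _++_ (msAt≡map-depths D v) (msAtL≡map-depthsL D B))
          (sym (List.map-++ (D ∸_) (depths v) (depthsL B)))

ms≡msAt : ∀ t → ms t ≡ msAt (degμ t) t
ms≡msAt t = sym (msAt≡map-depths (degμ t) t)

mutual
  msAt-mono : ∀ {E D} t → E ≤ D → msAt E t ≤ₘ msAt D t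
  msAt-mono (var x)   E≤D = ≤ₘ-refl
  msAt-mono (lam t)   E≤D = msAt-mono t E≤D
  msAt-mono (app t B) E≤D = ++-mono-≤ₘ (≤ₘ-singleton E≤D) (++-mono-≤ₘ (msAt-mono t E≤D) (msAtL-mono B E≤D))
  msAt-mono (mu b t)  E≤D = msAt-mono t (∸-monoˡ-≤ 1 E≤D)

  msAtL-mono : ∀ {E D} B → E ≤ D → msAtL E B ≤ₘ msAtL D B
  msAtL-mono []      E≤D = ≤ₘ-refl
  msAtL-mono (v ∷ B) E≤D = ++-mono-≤ₘ (msAt-mono v E≤D) (msAtL-mono B E≤D)

mutual
  msAt-bounded : ∀ D t → All (_≤ D) (msAt D t)
  msAt-bounded D (var x)   = []
  msAt-bounded D (lam t)   = msAt-bounded D t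
  msAt-bounded D (app t B) = ≤-refl ∷ All.++⁺ (msAt-bounded D t) (msAtL-bounded D B)
  msAt-bounded D (mu b t)  = All.map (λ k≤ → ≤-trans k≤ (m∸n≤m D 1)) (msAt-bounded (D ∸ 1) t)

  msAtL-bounded : ∀ D B → All (_≤ D) (msAtL D B)
  msAtL-bounded D []      = []
  msAtL-bounded D (v ∷ B) = All.++⁺ (msAt-bounded D v) (msAtL-bounded D B)

mutual
  degμ-renV : ∀ f t → degμ (renV f t) ≡ degμ t
  degμ-renV f (var x)   = refl
  degμ-renV f (lam t)   = degμ-renV (liftR f) t
  degμ-renV f (app t B) = cong₂ _+_ (degμ-renV f t) (degμL-renVL f B)
  degμ-renV f (mu b t)  = cong suc (degμ-renV f t)

  degμL-renVL : ∀ f B → degμL (renVL f B) ≡ degμL B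
  degμL-renVL f []      = refl
  degμL-renVL f (v ∷ B) = cong₂ _+_ (degμ-renV f v) (degμL-renVL f B)

mutual
  msAt-renV : ∀ f D t → msAt D (renV f t) ≡ msAt D t
  msAt-renV f D (var x)   = refl
  msAt-renV f D (lam t)   = msAt-renV (liftR f) D t
  msAt-renV f D (app t B) = cong (D ∷_) (cong₂ _++_ (msAt-renV f D t) (msAtL-renVL f D B))
  msAt-renV f D (mu b t)  = msAt-renV f (D ∸ 1) t

  msAtL-renVL : ∀ f D B → msAtL D (renVL f B) ≡ msAtL D B
  msAtL-renVL f D []      = refl
  msAtL-renVL f D (v ∷ B) = cong₂ _++_ (msAt-renV f D v) (msAtL-renVL f D B)

mutual
  degμ-renN : ∀ f t → degμ (renN f t) ≡ degμ t
  degμ-renN f (var x)   = refl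
  degμ-renN f (lam t)   = degμ-renN f t
  degμ-renN f (app t B) = cong₂ _+_ (degμ-renN f t) (degμL-renNL f B)
  degμ-renN f (mu b t)  = cong suc (degμ-renN (liftR f) t)

  degμL-renNL : ∀ f B → degμL (renNL f B) ≡ degμL B
  degμL-renNL f []      = refl
  degμL-renNL f (v ∷ B) = cong₂ _+_ (degμ-renN f v) (degμL-renNL f B)

mutual
  msAt-renN : ∀ f D t → msAt D (renN f t) ≡ msAt D t
  msAt-renN f D (var x)   = refl
  msAt-renN f D (lam t)   = msAt-renN f D t
  msAt-renN f D (app t B) = cong (D ∷_) (cong₂ _++_ (msAt-renN f D t) (msAtL-renNL f D B))
  msAt-renN f D (mu b t)  = msAt-renN (liftR f) (D ∸ 1) t

  msAtL-renNL : ∀ f D B → msAtL D (renNL f B) ≡ msAtL D B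
  msAtL-renNL f D []      = refl
  msAtL-renNL f D (v ∷ B) = cong₂ _++_ (msAt-renN f D v) (msAtL-renNL f D B)

degμL-++ : ∀ B C → degμL (B ++ C) ≡ degμL B + degμL C
degμL-++ []      C = refl
degμL-++ (v ∷ B) C = trans (cong (degμ v +_) (degμL-++ B C)) (sym (+-assoc (degμ v) (degμL B) (degμL C)))

msAtL-++ : ∀ D B C → msAtL D (B ++ C) ≡ msAtL D B ++ msAtL D C
msAtL-++ D []      C = refl
msAtL-++ D (v ∷ B) C =
  trans (cong (msAt D v ++_) (msAtL-++ D B C)) (sym (List.++-assoc (msAt D v) (msAtL D B) (msAtL D C)))

degμL-↭ : ∀ {B C} → B ↭ C → degμL B ≡ degμL C
degμL-↭ ↭.refl                 = refl
degμL-↭ (prep v B↭C)           = cong (degμ v +_) (degμL-↭ B↭C)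
degμL-↭ (swap {B} v w B↭C)     =
  trans (swap-+ (degμ v) (degμ w) (degμL B)) (cong (λ n → degμ w + (degμ v + n)) (degμL-↭ B↭C))
  where
  swap-+ : ∀ a b c → a + (b + c) ≡ b + (a + c)
  swap-+ = solve-∀
degμL-↭ (↭.trans B↭C C↭E)      = trans (degμL-↭ B↭C) (degμL-↭ C↭E)

msAtL-↭ : ∀ D {B C} → B ↭ C → msAtL D B ↭ msAtL D C
msAtL-↭ D ↭.refl            = ↭-refl
msAtL-↭ D (prep v B↭C)      = ++⁺ˡ (msAt D v) (msAtL-↭ D B↭C)
msAtL-↭ D (swap v w B↭C)    =
  ↭-trans (shifts (msAt D v) (msAt D w)) (++⁺ˡ (msAt D w) (++⁺ˡ (msAt D v) (msAtL-↭ D B↭C)))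
msAtL-↭ D (↭.trans B↭C C↭E) = ↭-trans (msAtL-↭ D B↭C) (msAtL-↭ D C↭E)

degμL-split : ∀ {B} B₁ B₂ → B ↭ B₁ ++ B₂ → degμL B ≡ degμL B₁ + degμL B₂
degμL-split B₁ B₂ B↭ = trans (degμL-↭ B↭) (degμL-++ B₁ B₂)

msAtL-split : ∀ D {B} B₁ B₂ → B ↭ B₁ ++ B₂ → msAtL D B ↭ msAtL D B₁ ++ msAtL D B₂
msAtL-split D B₁ B₂ B↭ = ↭-trans (msAtL-↭ D B↭) (↭-reflexive (msAtL-++ D B₁ B₂))

∈-concatMap⁻-find : ∀ {A C : Set} (f : A → List C) xs {y} → y ∈ concatMap f xs → ∃ λ x → x ∈ xs × y ∈ f x
∈-concatMap⁻-find f xs = find ∘ ∈-concatMap⁻ f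

splits-↭ : ∀ B {B₁ B₂} → (B₁ , B₂) ∈ splits B → B ↭ B₁ ++ B₂
splits-↭ []      (here refl) = ↭-refl
splits-↭ (a ∷ B) B₁B₂∈ with ∈-concatMap⁻-find _ (splits B) B₁B₂∈
... | (l , r) , lr∈ , here refl         = prep a (splits-↭ B lr∈)
... | (l , r) , lr∈ , there (here refl) = ↭-trans (prep a (splits-↭ B lr∈)) (↭-sym (shift a l r))

-- The shape shared by the application clauses of lsub, lsubL, napp and nappL.
∈-distribute⁻ : ∀ {A C R : Set} (f : Bag → List A) (h : Bag → List C) (g : A → C → R) B {r} →
  r ∈ concatMap (λ { (B₀ , B') → concatMap (λ a → map (g a) (h B')) (f B₀) }) (splits B) →
  ∃₂ λ B₀ B' → (B ↭ B₀ ++ B') × ∃₂ λ a c → a ∈ f B₀ × c ∈ h B' × r ≡ g a c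
∈-distribute⁻ f h g B r∈ with ∈-concatMap⁻-find _ (splits B) r∈
... | (B₀ , B') , B₀B'∈ , r∈₁ with ∈-concatMap⁻-find _ (f B₀) r∈₁
... | a , a∈ , r∈₂ with ∈-map⁻ (g a) r∈₂
... | c , c∈ , refl = B₀ , B' , splits-↭ B B₀B'∈ , a , c , a∈ , c∈ , refl

∈-substVar⁻ : ∀ k x B {s} → s ∈ substVar k x B → B ≡ [ s ] ⊎ (B ≡ [] × ∃ λ j → s ≡ var j)
∈-substVar⁻ k x B s∈ with k ≡ᵇ x
∈-substVar⁻ k x (v ∷ []) (here refl) | true  = inj₁ refl
∈-substVar⁻ k x []       (here refl) | false = inj₂ (refl , _ , refl)

+-collect : ∀ {a c b} t v b₀ b₁ → a ≡ t + b₀ → c ≡ v + b₁ → b ≡ b₀ + b₁ → a + c ≡ (t + v) + b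
+-collect t v b₀ b₁ refl refl refl = interchange t b₀ v b₁
  where
  interchange : ∀ a b c d → (a + b) + (c + d) ≡ (a + c) + (b + d)
  interchange = solve-∀

≤ₘ-collect : ∀ {M₀ M₁ L} a b c d → M₀ ≤ₘ a ++ b → M₁ ≤ₘ c ++ d → L ↭ b ++ d →
             M₀ ++ M₁ ≤ₘ (a ++ c) ++ L
≤ₘ-collect a b c d M₀≤ M₁≤ L↭ =
  ≤ₘ-resp-↭ ↭-refl (↭-trans (↭-interchange a b c d) (++⁺ˡ (a ++ c) (↭-sym L↭))) (++-mono-≤ₘ M₀≤ M₁≤)

mutual
  degμ-lsub : ∀ t x B {s} → s ∈ lsub t x B → degμ s ≡ degμ t + degμL B
  degμ-lsub (var k) x B s∈ with ∈-substVar⁻ k x B s∈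
  ... | inj₁ refl              = sym (+-identityʳ _)
  ... | inj₂ (refl , _ , refl) = refl
  degμ-lsub (lam t) x B s∈ with ∈-map⁻ lam s∈
  ... | s , s∈′ , refl =
        trans (degμ-lsub t (suc x) (renVL suc B) s∈′) (cong (degμ t +_) (degμL-renVL suc B))
  degμ-lsub (mu b t) x B s∈ with ∈-map⁻ (mu b) s∈
  ... | s , s∈′ , refl =
        cong suc (trans (degμ-lsub t x (renNL suc B) s∈′) (cong (degμ t +_) (degμL-renNL suc B)))
  degμ-lsub (app t vs) x B s∈ with ∈-distribute⁻ (lsub t x) (lsubL vs x) app B s∈
  ... | B₀ , B' , B↭ , s , ss , s∈′ , ss∈ , refl =
        +-collect (degμ t) (degμL vs) (degμL B₀) (degμL B')
                  (degμ-lsub t x B₀ s∈′) (degμL-lsubL vs x B' ss∈) (degμL-split B₀ B' B↭)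

  degμL-lsubL : ∀ vs x B {ss} → ss ∈ lsubL vs x B → degμL ss ≡ degμL vs + degμL B
  degμL-lsubL []       x [] (here refl) = refl
  degμL-lsubL (v ∷ vs) x B  ss∈ with ∈-distribute⁻ (lsub v x) (lsubL vs x) _∷_ B ss∈
  ... | B₁ , B₂ , B↭ , s , ss , s∈ , ss∈ , refl =
        +-collect (degμ v) (degμL vs) (degμL B₁) (degμL B₂)
                  (degμ-lsub v x B₁ s∈) (degμL-lsubL vs x B₂ ss∈) (degμL-split B₁ B₂ B↭)

-- Substitution moves the bags of B to depths at least as large, so their measures can only drop.
mutual
  msAt-lsub : ∀ t x B {s E D} → s ∈ lsub t x B → E ≤ D → msAt E s ≤ₘ msAt E t ++ msAtL D B
  msAt-lsub (var k) x B {s} s∈ E≤D with ∈-substVar⁻ k x B s∈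
  ... | inj₁ refl              = ≤ₘ-resp-↭ ↭-refl (↭-sym (++-identityʳ _)) (msAt-mono s E≤D)
  ... | inj₂ (refl , _ , refl) = ≤ₘ-refl
  msAt-lsub (lam t) x B {E = E} {D} s∈ E≤D with ∈-map⁻ lam s∈
  ... | s , s∈′ , refl =
        subst (λ L → msAt E s ≤ₘ msAt E t ++ L) (msAtL-renVL suc D B)
              (msAt-lsub t (suc x) (renVL suc B) s∈′ E≤D)
  msAt-lsub (mu b t) x B {E = E} {D} s∈ E≤D with ∈-map⁻ (mu b) s∈
  ... | s , s∈′ , refl =
        subst (λ L → msAt (E ∸ 1) s ≤ₘ msAt (E ∸ 1) t ++ L) (msAtL-renNL suc D B)
              (msAt-lsub t x (renNL suc B) s∈′ (≤-trans (m∸n≤m E 1) E≤D))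
  msAt-lsub (app t vs) x B {E = E} {D} s∈ E≤D with ∈-distribute⁻ (lsub t x) (lsubL vs x) app B s∈
  ... | B₀ , B' , B↭ , s , ss , s∈′ , ss∈ , refl =
        ++-mono-≤ₘ (≤ₘ-refl {[ E ]})
          (≤ₘ-collect (msAt E t) (msAtL D B₀) (msAtL E vs) (msAtL D B')
                      (msAt-lsub t x B₀ s∈′ E≤D) (msAtL-lsubL vs x B' ss∈ E≤D) (msAtL-split D B₀ B' B↭))

  msAtL-lsubL : ∀ vs x B {ss E D} → ss ∈ lsubL vs x B → E ≤ D → msAtL E ss ≤ₘ msAtL E vs ++ msAtL D B
  msAtL-lsubL []       x [] (here refl) E≤D = ≤ₘ-refl
  msAtL-lsubL (v ∷ vs) x B {E = E} {D} ss∈ E≤D with ∈-distribute⁻ (lsub v x) (lsubL vs x) _∷_ B ss∈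
  ... | B₁ , B₂ , B↭ , s , ss , s∈ , ss∈ , refl =
        ≤ₘ-collect (msAt E v) (msAtL D B₁) (msAtL E vs) (msAtL D B₂)
                   (msAt-lsub v x B₁ s∈ E≤D) (msAtL-lsubL vs x B₂ ss∈ E≤D) (msAtL-split D B₁ B₂ B↭)

ExtendsBelow : ℕ → List ℕ → List ℕ → Set
ExtendsBelow D M N = Σ (List ℕ) λ Y → All (_< D) Y × (M ↭ N ++ Y)

ExtendsBelow-refl : ∀ {D M} → ExtendsBelow D M M
ExtendsBelow-refl {M = M} = [] , [] , ↭-sym (++-identityʳ M)

ExtendsBelow-++ : ∀ {D M₁ N₁ M₂ N₂} → ExtendsBelow D M₁ N₁ → ExtendsBelow D M₂ N₂ →
                  ExtendsBelow D (M₁ ++ M₂) (N₁ ++ N₂)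
ExtendsBelow-++ {N₁ = N₁} {N₂ = N₂} (Y₁ , Y₁<D , M₁↭) (Y₂ , Y₂<D , M₂↭) =
  Y₁ ++ Y₂ , All.++⁺ Y₁<D Y₂<D , ↭-trans (++⁺ M₁↭ M₂↭) (↭-interchange N₁ Y₁ N₂ Y₂)

-- Applying the body of α|t| to a bag B₂ adds the entry E and the entries of B₂, all of them ≤ E.
ExtendsBelow-applied : ∀ {E D M N} B₂ → E < D → ExtendsBelow D M N →
                       ExtendsBelow D (E ∷ M ++ msAtL E B₂) N
ExtendsBelow-applied {E} {N = N} B₂ E<D (Y , Y<D , M↭) =
  E ∷ Y ++ msAtL E B₂ ,
  E<D ∷ All.++⁺ Y<D (All.map (λ k≤E → ≤-<-trans k≤E E<D) (msAtL-bounded E B₂)) ,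
  ↭-trans (prep E (↭-trans (++⁺ʳ (msAtL E B₂) M↭) (++-assoc N Y (msAtL E B₂))))
          (↭-sym (shift E N (Y ++ msAtL E B₂)))

mutual
  degμ-napp : ∀ t α B {s} → s ∈ napp t α B → degμ s ≡ degμ t + degμL B
  degμ-napp (var k) α [] (here refl) = refl
  degμ-napp (lam t) α B s∈ with ∈-map⁻ lam s∈
  ... | s , s∈′ , refl =
        trans (degμ-napp t α (renVL suc B) s∈′) (cong (degμ t +_) (degμL-renVL suc B))
  degμ-napp (mu η t) α B s∈ with ∈-map⁻ (mu η) s∈
  ... | s , s∈′ , refl =
        cong suc (trans (degμ-nappNamed η t (suc α) (renNL suc B) s∈′) (cong (degμ t +_) (degμL-renNL suc B)))
  degμ-napp (app t vs) α B s∈ with ∈-distribute⁻ (napp t α) (nappL vs α) app B s∈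
  ... | B₀ , B' , B↭ , s , ss , s∈′ , ss∈ , refl =
        +-collect (degμ t) (degμL vs) (degμL B₀) (degμL B')
                  (degμ-napp t α B₀ s∈′) (degμL-nappL vs α B' ss∈) (degμL-split B₀ B' B↭)

  degμL-nappL : ∀ vs α B {ss} → ss ∈ nappL vs α B → degμL ss ≡ degμL vs + degμL B
  degμL-nappL []       α [] (here refl) = refl
  degμL-nappL (v ∷ vs) α B  ss∈ with ∈-distribute⁻ (napp v α) (nappL vs α) _∷_ B ss∈
  ... | B₁ , B₂ , B↭ , s , ss , s∈ , ss∈ , refl =
        +-collect (degμ v) (degμL vs) (degμL B₁) (degμL B₂)
                  (degμ-napp v α B₁ s∈) (degμL-nappL vs α B₂ ss∈) (degμL-split B₁ B₂ B↭)

  degμ-nappNamed : ∀ η t α B {s} → s ∈ nappNamed η t α B → degμ s ≡ degμ t + degμL B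
  degμ-nappNamed η t α B s∈ with η ≡ᵇ α
  ... | false = degμ-napp t α B s∈
  ... | true with ∈-concatMap⁻-find _ (splits B) s∈
  ... | (B₁ , B₂) , B₁B₂∈ , s∈′ with ∈-map⁻ (λ s → app s B₂) s∈′
  ... | s , s∈″ , refl = begin
    degμ s + degμL B₂                 ≡⟨ cong (_+ degμL B₂) (degμ-napp t α B₁ s∈″) ⟩
    degμ t + degμL B₁ + degμL B₂      ≡⟨ +-assoc (degμ t) (degμL B₁) (degμL B₂) ⟩
    degμ t + (degμL B₁ + degμL B₂)    ≡⟨ cong (degμ t +_) (degμL-split B₁ B₂ (splits-↭ B B₁B₂∈)) ⟨
    degμ t + degμL B                  ∎
    where open ≡-Reasoning

mutual
  msAt-napp : ∀ t α B {s E D} → s ∈ napp t α B → E < D → ExtendsBelow D (msAt E s) (msAt E t)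
  msAt-napp (var k) α [] (here refl) E<D = ExtendsBelow-refl
  msAt-napp (lam t) α B s∈ E<D with ∈-map⁻ lam s∈
  ... | s , s∈′ , refl = msAt-napp t α (renVL suc B) s∈′ E<D
  msAt-napp (mu η t) α B {E = E} s∈ E<D with ∈-map⁻ (mu η) s∈
  ... | s , s∈′ , refl = msAt-nappNamed η t (suc α) (renNL suc B) s∈′ (≤-<-trans (m∸n≤m E 1) E<D)
  msAt-napp (app t vs) α B {E = E} s∈ E<D with ∈-distribute⁻ (napp t α) (nappL vs α) app B s∈
  ... | B₀ , B' , B↭ , s , ss , s∈′ , ss∈ , refl =
        ExtendsBelow-++ {M₁ = [ E ]} ExtendsBelow-refl
          (ExtendsBelow-++ (msAt-napp t α B₀ s∈′ E<D) (msAtL-nappL vs α B' ss∈ E<D))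

  msAtL-nappL : ∀ vs α B {ss E D} → ss ∈ nappL vs α B → E < D → ExtendsBelow D (msAtL E ss) (msAtL E vs)
  msAtL-nappL []       α [] (here refl) E<D = ExtendsBelow-refl
  msAtL-nappL (v ∷ vs) α B ss∈ E<D with ∈-distribute⁻ (napp v α) (nappL vs α) _∷_ B ss∈
  ... | B₁ , B₂ , B↭ , s , ss , s∈ , ss∈ , refl =
        ExtendsBelow-++ (msAt-napp v α B₁ s∈ E<D) (msAtL-nappL vs α B₂ ss∈ E<D)

  msAt-nappNamed : ∀ η t α B {s E D} → s ∈ nappNamed η t α B → E < D → ExtendsBelow D (msAt E s) (msAt E t)
  msAt-nappNamed η t α B s∈ E<D with η ≡ᵇ α
  ... | false = msAt-napp t α B s∈ E<D
  ... | true with ∈-concatMap⁻-find _ (splits B) s∈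
  ... | (B₁ , B₂) , _ , s∈′ with ∈-map⁻ (λ s → app s B₂) s∈′
  ... | s , s∈″ , refl = ExtendsBelow-applied B₂ E<D (msAt-napp t α B₁ s∈″ E<D)

-- D is the μ-degree of an ambient term containing t, which the step lowers to D ∸ δ; a ρ-step keeps
-- every bag at its depth and removes one μ.
data Decrease (t s : Term) : Set where
  shrinks : ∀ δ → degμ s + δ ≡ degμ t → (∀ D → degμ t ≤ D → msAt (D ∸ δ) s <ₘ msAt D t) → Decrease t s
  renames : suc (degμ s) ≡ degμ t → (∀ D → msAt (D ∸ 1) s ≡ msAt D t) → Decrease t s

Decrease⇒<ˡᵉˣ : ∀ {t s} → Decrease t s → 𝐦 s <ˡᵉˣ 𝐦 t
Decrease⇒<ˡᵉˣ {t} {s} (shrinks δ s+δ≡t smaller) =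
  inj₁ (subst₂ _<ₘ_ (trans (cong (λ k → msAt k s) t∸δ≡s) (sym (ms≡msAt s))) (sym (ms≡msAt t))
               (smaller (degμ t) ≤-refl))
  where
  t∸δ≡s : degμ t ∸ δ ≡ degμ s
  t∸δ≡s = trans (cong (_∸ δ) (sym s+δ≡t)) (m+n∸n≡m (degμ s) δ)
Decrease⇒<ˡᵉˣ {t} {s} (renames 1+s≡t same) =
  inj₂ (↭-reflexive ms-s≡ms-t , subst (degμ s <_) 1+s≡t (n<1+n (degμ s)))
  where
  open ≡-Reasoning
  ms-s≡ms-t : ms s ≡ ms t
  ms-s≡ms-t = begin
    ms s                      ≡⟨ ms≡msAt s ⟩
    msAt (suc (degμ s) ∸ 1) s ≡⟨ cong (λ k → msAt (k ∸ 1) s) 1+s≡t ⟩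
    msAt (degμ t ∸ 1) s       ≡⟨ same (degμ t) ⟩
    msAt (degμ t) t           ≡⟨ ms≡msAt t ⟨
    ms t                      ∎

Decrease-lam : ∀ {t s} → Decrease t s → Decrease (lam t) (lam s)
Decrease-lam (shrinks δ s+δ≡t smaller) = shrinks δ s+δ≡t smaller
Decrease-lam (renames 1+s≡t same)      = renames 1+s≡t same

Decrease-mu : ∀ {t s} b → Decrease t s → Decrease (mu b t) (mu b s)
Decrease-mu {t} {s} b (shrinks δ s+δ≡t smaller) = shrinks δ (cong suc s+δ≡t) below
  where
  below : ∀ D → suc (degμ t) ≤ D → msAt (D ∸ δ ∸ 1) s <ₘ msAt (D ∸ 1) t
  below (suc D) 1+t≤1+D = subst (λ k → msAt k s <ₘ msAt D t) D∸δ≡ (smaller D (s≤s⁻¹ 1+t≤1+D))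
    where
    D∸δ≡ : D ∸ δ ≡ suc D ∸ δ ∸ 1
    D∸δ≡ = sym (trans (∸-+-assoc (suc D) δ 1) (cong (suc D ∸_) (+-comm δ 1)))
Decrease-mu b (renames 1+s≡t same) = renames (cong suc 1+s≡t) (λ D → same (D ∸ 1))

-- An application with a hole in its head or in its bag.
record Frame (C : Term → Term) : Set where
  field
    offset    : ℕ
    rest      : ℕ → List ℕ
    degμ-plug : ∀ u → degμ (C u) ≡ degμ u + offset
    msAt-plug : ∀ D u → msAt D (C u) ↭ D ∷ msAt D u ++ rest D
    rest-mono : ∀ {E D} → E ≤ D → rest E ≤ₘ rest D

  degμ-hole≤ : ∀ u → degμ u ≤ degμ (C u)
  degμ-hole≤ u = subst (degμ u ≤_) (sym (degμ-plug u)) (m≤m+n (degμ u) offset)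

head-frame : ∀ B → Frame (λ u → app u B)
head-frame B = record
  { offset    = degμL B
  ; rest      = λ D → msAtL D B
  ; degμ-plug = λ _ → refl
  ; msAt-plug = λ _ _ → ↭-refl
  ; rest-mono = msAtL-mono B
  }

argument-frame : ∀ t B₁ B₂ → Frame (λ u → app t (B₁ ++ u ∷ B₂))
argument-frame t B₁ B₂ = record
  { offset    = degμ t + degμL B₁ + degμL B₂
  ; rest      = λ D → (msAt D t ++ msAtL D B₁) ++ msAtL D B₂
  ; degμ-plug = λ u → trans (cong (degμ t +_) (degμL-++ B₁ (u ∷ B₂)))
                            (rearrange (degμ t) (degμL B₁) (degμ u) (degμL B₂))
  ; msAt-plug = λ D u →
      prep D (↭-trans (↭-reflexive (plug-≡ D u)) (shifts (msAt D t ++ msAtL D B₁) (msAt D u)))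
  ; rest-mono = λ E≤D → ++-mono-≤ₘ (++-mono-≤ₘ (msAt-mono t E≤D) (msAtL-mono B₁ E≤D)) (msAtL-mono B₂ E≤D)
  }
  where
  rearrange : ∀ a b c d → a + (b + (c + d)) ≡ c + (a + b + d)
  rearrange = solve-∀
  plug-≡ : ∀ D u → msAt D t ++ msAtL D (B₁ ++ u ∷ B₂) ≡ (msAt D t ++ msAtL D B₁) ++ msAt D u ++ msAtL D B₂
  plug-≡ D u = trans (cong (msAt D t ++_) (msAtL-++ D B₁ (u ∷ B₂)))
                     (sym (List.++-assoc (msAt D t) (msAtL D B₁) (msAt D u ++ msAtL D B₂)))

Decrease-frame : ∀ {C u s} → Frame C → Decrease u s → Decrease (C u) (C s)
Decrease-frame {C} {u} {s} F (shrinks δ s+δ≡u smaller) = shrinks δ degree below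
  where
  open Frame F
  degree : degμ (C s) + δ ≡ degμ (C u)
  degree = begin
    degμ (C s) + δ        ≡⟨ cong (_+ δ) (degμ-plug s) ⟩
    degμ s + offset + δ   ≡⟨ swap-last (degμ s) offset δ ⟩
    degμ s + δ + offset   ≡⟨ cong (_+ offset) s+δ≡u ⟩
    degμ u + offset       ≡⟨ degμ-plug u ⟨
    degμ (C u)            ∎
    where
    open ≡-Reasoning
    swap-last : ∀ a b c → a + b + c ≡ a + c + b
    swap-last = solve-∀
  below : ∀ D → degμ (C u) ≤ D → msAt (D ∸ δ) (C s) <ₘ msAt D (C u)
  below D C-u≤D =
    <ₘ-resp-↭ (msAt-plug (D ∸ δ) s) (↭-sym (msAt-plug D u))
      (++-mono-≤ₘ-<ₘ (≤ₘ-singleton (m∸n≤m D δ))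
        (++-mono-<ₘ-≤ₘ (smaller D (≤-trans (degμ-hole≤ u) C-u≤D)) (rest-mono (m∸n≤m D δ))))
Decrease-frame {C} {u} {s} F (renames 1+s≡u same) = shrinks 1 degree below
  where
  open Frame F
  degree : degμ (C s) + 1 ≡ degμ (C u)
  degree = begin
    degμ (C s) + 1        ≡⟨ cong (_+ 1) (degμ-plug s) ⟩
    degμ s + offset + 1   ≡⟨ +-comm (degμ s + offset) 1 ⟩
    suc (degμ s + offset) ≡⟨ cong (_+ offset) 1+s≡u ⟩
    degμ u + offset       ≡⟨ degμ-plug u ⟨
    degμ (C u)            ∎
    where open ≡-Reasoning
  below : ∀ D → degμ (C u) ≤ D → msAt (D ∸ 1) (C s) <ₘ msAt D (C u)
  below zero C-u≤0 = contradiction (≤-trans (subst (_≤ degμ (C u)) (sym 1+s≡u) (degμ-hole≤ u)) C-u≤0) λ ()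
  below (suc D) _ =
    <ₘ-resp-↭ (msAt-plug D s) (↭-sym (msAt-plug (suc D) u))
      (++-mono-<ₘ-≤ₘ (<ₘ-singleton (n<1+n D))
        (++-mono-≤ₘ (≤ₘ-reflexive (↭-reflexive (same (suc D)))) (rest-mono (n≤1+n D))))

reduct-Decrease : ∀ {t 𝒮} → t ⟶ 𝒮 → ∀ {s} → s ∈ 𝒮 → Decrease t s
reduct-Decrease (βr {t} {B}) {s} s∈ =
  shrinks 0 (trans (+-identityʳ (degμ s)) (degμ-lsub t 0 B s∈))
         (λ D _ → ≤ₘ⇒<ₘ-∷ (msAt-lsub t 0 B s∈ ≤-refl))
reduct-Decrease (μr {b} {t} {B}) s∈ with ∈-map⁻ (mu b) s∈
... | s , s∈′ , refl = shrinks 0 degree below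
  where
  degree : degμ (mu b s) + 0 ≡ degμ (app (mu b t) B)
  degree = trans (+-identityʳ _) (cong suc (trans (degμ-nappNamed b t 0 (renNL suc B) s∈′)
                                                  (cong (degμ t +_) (degμL-renNL suc B))))
  below : ∀ D → degμ (app (mu b t) B) ≤ D → msAt D (mu b s) <ₘ msAt D (app (mu b t) B)
  below (suc D) _ =
    let Y , Y<1+D , s↭ = msAt-nappNamed b t 0 (renNL suc B) s∈′ (n<1+n D)
    in  <ₘ-resp-↭ s↭ ↭-refl (<ₘ-trade (msAt D t) (msAtL (suc D) B) Y<1+D)
reduct-Decrease (ρr {a} {e} {t}) (here refl) =
  renames (cong (suc ∘ suc) (degμ-renN (rhoRen a) t)) (λ D → msAt-renN (rhoRen a) (D ∸ 1 ∸ 1) t)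
reduct-Decrease (lamᶜ t⟶) s∈ with ∈-map⁻ lam s∈
... | s , s∈′ , refl = Decrease-lam (reduct-Decrease t⟶ s∈′)
reduct-Decrease (muᶜ {b} t⟶) s∈ with ∈-map⁻ (mu b) s∈
... | s , s∈′ , refl = Decrease-mu b (reduct-Decrease t⟶ s∈′)
reduct-Decrease (appˡ {B = B} t⟶) s∈ with ∈-map⁻ (λ s → app s B) s∈
... | s , s∈′ , refl = Decrease-frame (head-frame B) (reduct-Decrease t⟶ s∈′)
reduct-Decrease (appʳ {t} {B₁} {B₂ = B₂} t⟶) s∈ with ∈-map⁻ (λ s → app t (B₁ ++ s ∷ B₂)) s∈
... | s , s∈′ , refl = Decrease-frame (argument-frame t B₁ B₂) (reduct-Decrease t⟶ s∈′)

↭-Pointwise-commute : ∀ {A : Set} {R : A → A → Set} {As Bs Cs : List A} → As ↭ Bs → Pointwise R Bs Cs →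
                      Σ (List A) λ Ds → Pointwise R As Ds × (Ds ↭ Cs)
↭-Pointwise-commute ↭.refl            Bs~Cs               = _ , Bs~Cs , ↭-refl
↭-Pointwise-commute (prep x As↭Bs)    (x~c ∷ Bs~Cs)       with ↭-Pointwise-commute As↭Bs Bs~Cs
... | _ , As~Ds , Ds↭Cs = _ , x~c ∷ As~Ds , prep _ Ds↭Cs
↭-Pointwise-commute (swap x y As↭Bs)  (y~c ∷ x~d ∷ Bs~Cs) with ↭-Pointwise-commute As↭Bs Bs~Cs
... | _ , As~Ds , Ds↭Cs = _ , x~d ∷ y~c ∷ As~Ds , swap _ _ Ds↭Cs
↭-Pointwise-commute (↭.trans As↭Bs Bs↭Cs) Cs~Es with ↭-Pointwise-commute Bs↭Cs Cs~Es
... | Ds , Bs~Ds , Ds↭Es with ↭-Pointwise-commute As↭Bs Bs~Ds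
... | Fs , As~Fs , Fs↭Ds = Fs , As~Fs , ↭-trans Fs↭Ds Ds↭Es

mutual
  ≃-refl : ∀ t → t ≃ t
  ≃-refl (var x)   = var
  ≃-refl (lam t)   = lam (≃-refl t)
  ≃-refl (app t B) = app (≃-refl t) (bagEq (Pointwise-≃-refl B) ↭-refl)
  ≃-refl (mu b t)  = mu (≃-refl t)

  Pointwise-≃-refl : ∀ B → Pointwise _≃_ B B
  Pointwise-≃-refl []      = []
  Pointwise-≃-refl (v ∷ B) = ≃-refl v ∷ Pointwise-≃-refl B

mutual
  ≃-sym : ∀ {t u} → t ≃ u → u ≃ t
  ≃-sym var     = var
  ≃-sym (lam p) = lam (≃-sym p)
  ≃-sym (app p (bagEq B~D D↭C)) with ↭-Pointwise-commute (↭-sym D↭C) (Pointwise-≃-sym B~D)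
  ... | _ , C~E , E↭B = app (≃-sym p) (bagEq C~E E↭B)
  ≃-sym (mu p)  = mu (≃-sym p)

  Pointwise-≃-sym : ∀ {B C} → Pointwise _≃_ B C → Pointwise _≃_ C B
  Pointwise-≃-sym []            = []
  Pointwise-≃-sym (p ∷ B~C)     = ≃-sym p ∷ Pointwise-≃-sym B~C

mutual
  ≃-trans : ∀ {t u v} → t ≃ u → u ≃ v → t ≃ v
  ≃-trans var     var     = var
  ≃-trans (lam p) (lam q) = lam (≃-trans p q)
  ≃-trans (app p (bagEq B~D D↭C)) (app q (bagEq C~F F↭E)) with ↭-Pointwise-commute D↭C C~F
  ... | _ , D~G , G↭F = app (≃-trans p q) (bagEq (Pointwise-≃-trans B~D D~G) (↭-trans G↭F F↭E))
  ≃-trans (mu p)  (mu q)  = mu (≃-trans p q)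

  Pointwise-≃-trans : ∀ {B C E} → Pointwise _≃_ B C → Pointwise _≃_ C E → Pointwise _≃_ B E
  Pointwise-≃-trans []        []        = []
  Pointwise-≃-trans (p ∷ B~C) (q ∷ C~E) = ≃-trans p q ∷ Pointwise-≃-trans B~C C~E

≃-setoid : Setoid 0ℓ 0ℓ
≃-setoid = record
  { Carrier       = Term
  ; _≈_           = _≃_
  ; isEquivalence = record { refl = ≃-refl _ ; sym = ≃-sym ; trans = ≃-trans }
  }

mutual
  degμ-≃ : ∀ {t u} → t ≃ u → degμ t ≡ degμ u
  degμ-≃ var                   = refl
  degμ-≃ (lam p)               = degμ-≃ p
  degμ-≃ (app p (bagEq B~D D↭C)) = cong₂ _+_ (degμ-≃ p) (trans (degμL-Pointwise B~D) (degμL-↭ D↭C))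
  degμ-≃ (mu p)                = cong suc (degμ-≃ p)

  degμL-Pointwise : ∀ {B C} → Pointwise _≃_ B C → degμL B ≡ degμL C
  degμL-Pointwise []        = refl
  degμL-Pointwise (p ∷ B~C) = cong₂ _+_ (degμ-≃ p) (degμL-Pointwise B~C)

mutual
  msAt-≃ : ∀ {t u} → t ≃ u → ∀ D → msAt D t ↭ msAt D u
  msAt-≃ var                     D = ↭-refl
  msAt-≃ (lam p)                 D = msAt-≃ p D
  msAt-≃ (app p (bagEq B~D D↭C)) D =
    prep D (++⁺ (msAt-≃ p D) (↭-trans (msAtL-Pointwise B~D D) (msAtL-↭ D D↭C)))
  msAt-≃ (mu p)                  D = msAt-≃ p (D ∸ 1)

  msAtL-Pointwise : ∀ {B C} → Pointwise _≃_ B C → ∀ D → msAtL D B ↭ msAtL D C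
  msAtL-Pointwise []        D = ↭-refl
  msAtL-Pointwise (p ∷ B~C) D = ++⁺ (msAt-≃ p D) (msAtL-Pointwise B~C D)

ms-≃ : ∀ {t u} → t ≃ u → ms t ↭ ms u
ms-≃ {t} {u} t≃u = subst₂ _↭_ (sym (ms≡msAt t)) (sym (ms≡msAt u))
                          (subst (λ k → msAt (degμ t) t ↭ msAt k u) (degμ-≃ t≃u) (msAt-≃ t≃u (degμ t)))

infix 4 _≺_
_≺_ : Term → Term → Set
_≺_ = _<ˡᵉˣ_ on 𝐦

≺-wellFounded : WellFounded _≺_
≺-wellFounded = On.wellFounded 𝐦 <ˡᵉˣ-wellFounded

≺-respˡ-≃ : ∀ {t u v} → t ≃ u → u ≺ v → t ≺ v
≺-respˡ-≃ t≃u (inj₁ u<v)        = inj₁ (<ₘ-resp-↭ (ms-≃ t≃u) ↭-refl u<v)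
≺-respˡ-≃ t≃u (inj₂ (u↭v , u<v)) = inj₂ (↭-trans (ms-≃ t≃u) u↭v , subst (_< _) (sym (degμ-≃ t≃u)) u<v)

≺-respʳ-≃ : ∀ {t u v} → u ≃ v → t ≺ u → t ≺ v
≺-respʳ-≃ u≃v (inj₁ t<u)        = inj₁ (<ₘ-resp-↭ ↭-refl (ms-≃ u≃v) t<u)
≺-respʳ-≃ u≃v (inj₂ (t↭u , t<u)) = inj₂ (↭-trans t↭u (ms-≃ u≃v) , subst (_ <_) (degμ-≃ u≃v) t<u)

reduct-≺ : ∀ {t 𝒮 u} → t ⟶ 𝒮 → u ∈ˢ 𝒮 → u ≺ t
reduct-≺ {t} t⟶𝒮 u∈𝒮 with find u∈𝒮
... | s , s∈𝒮 , u≃s = ≺-respˡ-≃ {v = t} u≃s (Decrease⇒<ˡᵉˣ (reduct-Decrease t⟶𝒮 s∈𝒮))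

open import Data.List.Relation.Unary.Unique.Setoid ≃-setoid using (Unique)
open import Data.List.Relation.Binary.Subset.Setoid ≃-setoid using (_⊆_)
open import Data.List.Relation.Binary.Disjoint.Setoid ≃-setoid using (Disjoint)
import Data.List.Relation.Binary.Permutation.Setoid.Properties ≃-setoid as Permutationₛ

∈⇒∈ˢ : ∀ {u S} → u ∈ S → u ∈ˢ S
∈⇒∈ˢ = Any.map λ { refl → ≃-refl _ }

≈ˢ⇒⊆ : ∀ {S T} → S ≈ˢ T → S ⊆ T
≈ˢ⇒⊆ S≈T = Equivalence.to (S≈T _)

≈ˢ⇒⊇ : ∀ {S T} → S ≈ˢ T → T ⊆ S
≈ˢ⇒⊇ S≈T = Equivalence.from (S≈T _)

⊆⇒≈ˢ : ∀ {S T} → S ⊆ T → T ⊆ S → S ≈ˢ T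
⊆⇒≈ˢ S⊆T T⊆S _ = mk⇔ S⊆T T⊆S

record FreshPart (R T : Sum) : Set where
  field
    reps   : List Term
    unique : Unique reps
    ⊆T     : reps ⊆ T
    ∉R     : Disjoint R reps
    covers : T ⊆ R ++ reps

-- Deciding membership up to _≃_ would need a decision procedure for bag equality; since every use of
-- this lemma is towards ⊥, double negation suffices.
¬¬-freshPart : ∀ R T → ¬ ¬ FreshPart R T
¬¬-freshPart R []      ¬fresh =
  ¬fresh record { reps = [] ; unique = [] ; ⊆T = λ () ; ∉R = λ () ; covers = λ () }
¬¬-freshPart R (u ∷ T) = do
    P       ← ¬¬-freshPart R T
    u∈R?    ← ¬¬-excluded-middle
    u∈reps? ← ¬¬-excluded-middle
    pure (extend P u∈R? u∈reps?)
  where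
  open RawMonad ¬¬-Monad
  extend : (P : FreshPart R T) → Dec (u ∈ˢ R) → Dec (u ∈ˢ FreshPart.reps P) → FreshPart R (u ∷ T)
  extend P (yes u∈R) _ = record
    { reps = reps ; unique = unique ; ⊆T = there ∘ ⊆T ; ∉R = ∉R
    ; covers = Subset.∈-∷⁺ʳ ≃-setoid (Any.++⁺ˡ u∈R) covers }
    where open FreshPart P
  extend P (no _) (yes u∈reps) = record
    { reps = reps ; unique = unique ; ⊆T = there ∘ ⊆T ; ∉R = ∉R
    ; covers = Subset.∈-∷⁺ʳ ≃-setoid (Any.++⁺ʳ R u∈reps) covers }
    where open FreshPart P
  extend P (no u∉R) (no u∉reps) = record
    { reps   = u ∷ reps
    ; unique = Membershipₛ.∉⇒All[≉] ≃-setoid u∉reps ∷ unique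
    ; ⊆T     = Subset.∷⁺ʳ ≃-setoid u ⊆T
    ; ∉R     = λ { (v∈R , here v≃u) → u∉R (Membershipₛ.∈-resp-≈ ≃-setoid v≃u v∈R)
                 ; (v∈R , there v∈reps) → ∉R (v∈R , v∈reps) }
    ; covers = Subset.∈-∷⁺ʳ ≃-setoid (Any.++⁺ʳ R (here (≃-refl u)))
                 (Subset.++⁺ʳ ≃-setoid R (Subset.xs⊆x∷xs ≃-setoid reps u) ∘ covers)
    }
    where open FreshPart P

Represents : List Term → Sum → Set
Represents L S = Unique L × L ≈ˢ S

open MultisetExtension _≺_ using (_◁_; ◁-wellFounded)

-- The reduced term t is represented by exactly one t̃ in L; it is replaced by fresh representatives
-- of the reducts, each of them ≺ t̃.
step-◁ : ∀ {L S S'} → Represents L S → S ⟶ˢ S' → ¬ ¬ (Σ (List Term) λ L' → Represents L' S' × L' ◁ L)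
step-◁ {S' = S'} (L! , L≈S) (step {t = t} {T} {R} t⟶T t∉R S≈t∷R S'≈T++R)
  with find (≈ˢ⇒⊇ L≈S (≈ˢ⇒⊇ S≈t∷R (here (≃-refl t))))
... | t̃ , t̃∈L , t≃t̃ with ∈-∃++ t̃∈L
... | L₁ , L₂ , refl
  with Permutationₛ.Unique-resp-↭ (↭⇒↭ₛ′ (Setoid.isEquivalence ≃-setoid) (shift t̃ L₁ L₂)) L!
... | t̃≉C ∷ C! = ¬¬-map replace (¬¬-freshPart R T)
  where
  C = L₁ ++ L₂

  C⊆R : C ⊆ R
  C⊆R c∈C with ≈ˢ⇒⊆ S≈t∷R (≈ˢ⇒⊆ L≈S (Any-resp-↭ (↭-sym (shift t̃ L₁ L₂)) (there c∈C)))
  ... | here c≃t  = contradiction (Membershipₛ.∈-resp-≈ ≃-setoid (≃-trans c≃t t≃t̃) c∈C)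
                                  (Membershipₛ.All[≉]⇒∉ ≃-setoid t̃≉C)
  ... | there c∈R = c∈R

  R⊆C : R ⊆ C
  R⊆C r∈R with Any-resp-↭ (shift t̃ L₁ L₂) (≈ˢ⇒⊇ L≈S (≈ˢ⇒⊇ S≈t∷R (there r∈R)))
  ... | here r≃t̃  = contradiction (Membershipₛ.∈-resp-≈ ≃-setoid (≃-trans r≃t̃ (≃-sym t≃t̃)) r∈R) t∉R
  ... | there r∈C = r∈C

  replace : FreshPart R T → Σ (List Term) λ L' → Represents L' S' × L' ◁ (L₁ ++ t̃ ∷ L₂)
  replace P = C ++ reps
            , (Unique.++⁺ ≃-setoid C! unique (λ (v∈C , v∈reps) → ∉R (C⊆R v∈C , v∈reps)) ,
               ⊆⇒≈ˢ (≈ˢ⇒⊇ S'≈T++R ∘ ⊆T++R) (⊇T++R ∘ ≈ˢ⇒⊆ S'≈T++R))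
            , (t̃ , C , reps , shift t̃ L₁ L₂ , ++-comm C reps ,
               All.tabulate λ {b} b∈ → ≺-respʳ-≃ {b} t≃t̃ (reduct-≺ t⟶T (⊆T (∈⇒∈ˢ b∈))))
    where
    open FreshPart P
    ⊆T++R : C ++ reps ⊆ T ++ R
    ⊆T++R v∈ with Any.++⁻ C v∈
    ... | inj₁ v∈C    = Any.++⁺ʳ T (C⊆R v∈C)
    ... | inj₂ v∈reps = Any.++⁺ˡ (⊆T v∈reps)
    ⊇T++R : T ++ R ⊆ C ++ reps
    ⊇T++R v∈ with Any.++⁻ T v∈
    ... | inj₂ v∈R = Any.++⁺ˡ (R⊆C v∈R)
    ... | inj₁ v∈T with Any.++⁻ R (covers v∈T)
    ...   | inj₁ v∈R    = Any.++⁺ˡ (R⊆C v∈R)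
    ...   | inj₂ v∈reps = Any.++⁺ʳ C v∈reps

no-infinite-chain : (f : ℕ → Sum) → (∀ n → f n ⟶ˢ f (suc n)) →
                    ∀ n {L} → Acc _◁_ L → Represents L (f n) → ⊥
no-infinite-chain f steps n (acc smaller) L-rep =
  step-◁ L-rep (steps n) λ (L' , L'-rep , L'◁L) → no-infinite-chain f steps (suc n) (smaller L'◁L) L'-rep

strongly-normalising : StronglyNormalising
strongly-normalising f steps = ¬¬-freshPart [] (f 0) λ P →
  let open FreshPart P in
  no-infinite-chain f steps 0 (◁-wellFounded ≺-wellFounded reps) (unique , ⊆⇒≈ˢ ⊆T covers)

corollary2p13 : ((t t' : Term) (𝒮 𝒯 : Sum) → t ⟶ 𝒮 → 𝒮 ≈ˢ (t' ∷ 𝒯) → 𝐦 t' <ˡᵉˣ 𝐦 t)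
                × StronglyNormalising
corollary2p13 = (λ t t' 𝒮 𝒯 t⟶𝒮 𝒮≈t'∷𝒯 → reduct-≺ t⟶𝒮 (≈ˢ⇒⊇ 𝒮≈t'∷𝒯 (here (≃-refl t'))))
              , strongly-normalising
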